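{- Fix $p\in(0,1)$ and let $A(p)$ be the random set defined in the context below. Then, for all $k\ge1$, $$\mathbb{P}(F_k\in A(p))=\frac{p}{p+1}+O(p^k),$$ where the implied constant is independent of $k$.
   Context: The Fibonacci numbers are normalized as $F_1=1$, $F_2=2$, $F_{n+1}=F_n+F_{n-1}$. The random sets are built recursively. Let $A_0(p)=\emptyset$. For $n\ge1$: - if $F_{n-1}\in A_{n-1}(p)$, then $A_n(p)=A_{n-1}(p)$; - otherwise, $A_n(p)=A_{n-1}(p)\cup\{F_n\}$ with probability $p$, and $A_n(p)=A_{n-1}(p)$ with probability $1-p$. The random choices are independent, and $F_1$ is included with probability $p$. Let $A(p)=\bigcup_n A_n(p)$.
   Formalization: The parameter p ranges over the rationals in $(0,1)$ rather than over all of that interval. -}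

module Defs where

open import Data.Bool using (Bool; true; false; if_then_else_; _∧_; not)
open import Data.Nat as ℕ using (ℕ; zero; suc; s≤s; z≤n)
open import Data.List using (List; []; _∷_; map; _++_; foldr)
open import Data.List.Membership.DecPropositional ℕ._≟_ using (_∈?_)
open import Data.Rational using (ℚ; 0ℚ; 1ℚ; _+_; _*_; _-_; _÷_; _<_; >-nonZero)
open import Data.Rational.Properties using (+-mono-<)
open import Data.Rational using (*<*)
open import Data.Integer using (+<+)
open import Relation.Nullary using (does)

-- Fibonacci numbers normalised as F 1 = 1, F 2 = 2, F (n+1) = F n + F (n-1).
-- (F 0 is never used; it is set to 0 arbitrarily.)
F : ℕ → ℕ
F zero = 0
F (suc zero) = 1
F (suc (suc zero)) = 2
F (suc (suc (suc n))) = F (suc (suc n)) ℕ.+ F (suc n)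

-- A coin sequence: ω i is the outcome (true = "include", probability p)
-- of the independent choice made at step i+1.
-- A ω n is the set A_n (as a list of naturals).
A : (ℕ → Bool) → ℕ → List ℕ
A ω zero = []
A ω (suc n) =
  if blocked then A ω n
  else (if ω n then F (suc n) ∷ A ω n else A ω n)
  where
  -- at step n+1 the condition is F_n ∈ A_n; at step 1 there is no condition
  blocked : Bool
  blocked = not (n ℕ.≡ᵇ 0) ∧ does (F n ∈? A ω n)

allBools : ℕ → List (List Bool)
allBools zero = [] ∷ []
allBools (suc n) = map (true ∷_) (allBools n) ++ map (false ∷_) (allBools n)

toSeq : List Bool → ℕ → Bool
toSeq [] _ = false
toSeq (b ∷ bs) zero = b
toSeq (b ∷ bs) (suc i) = toSeq bs i

weight : ℚ → List Bool → ℚ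
weight p [] = 1ℚ
weight p (b ∷ bs) = (if b then p else 1ℚ - p) * weight p bs

sumℚ : List ℚ → ℚ
sumℚ = foldr _+_ 0ℚ

probIn : ℚ → ℕ → ℕ → ℚ
probIn p n k =
  sumℚ (map (λ bs → weight p bs * (if does (F k ∈? A (toSeq bs) n) then 1ℚ else 0ℚ))
           (allBools n))

pow : ℚ → ℕ → ℚ
pow p zero = 1ℚ
pow p (suc n) = p * pow p n

0<1 : 0ℚ < 1ℚ
0<1 = *<* (+<+ (s≤s z≤n))

ratio : (p : ℚ) → 0ℚ < p → ℚ
ratio p 0<p = (p ÷ (p + 1ℚ)) {{>-nonZero (+-mono-< 0<p 0<1)}}

{-# OPTIONS --safe #-}
-- F_{k+1} ∈ A exactly when F_k ∉ A and the coin of step k+1 shows heads, so membership is a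
-- two-state chain driven by the coins, and whether F_{k+1} ∈ A is decided by step k+1.
-- Conditioning on the first coin instead (heads puts F_1 in and blocks F_2, tails leaves
-- F_1 out) gives the renewal equation q_{k+2} = p q_k + (1 - p) q_{k+1} for q_k = ℙ(F_k ∈ A),
-- with q_0 = 0 and q_1 = p. Its solution is q_k = r - r (-p)^k with r = p/(p+1), and
-- |r (-p)^k| = r p^k.
module Submission where

open import Defs
open import Data.Nat using (ℕ)
open import Data.Product using (_×_; ∃-syntax)
open import Data.Rational using (ℚ; 0ℚ; 1ℚ; _+_; _*_; _-_; _<_; _≤_; ∣_∣)

open import Data.Bool using (Bool; true; false; not; _∧_; _∨_; if_then_else_)
open import Data.List using (List; []; _∷_; map; _++_)
import Data.List.Properties as List
open import Data.Maybe using (Maybe; just; nothing)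
open import Data.Nat as ℕ using (zero; suc; s≤s; z≤n)
import Data.Nat.Properties as ℕₚ
open import Data.List.Membership.DecPropositional ℕ._≟_ using (_∈?_)
open import Data.Product using (_,_)
open import Data.Rational using (-_; 1/_; positive; Positive; NonZero)
import Data.Rational.Properties as ℚₚ
open import Algebra.Properties.Group ℚₚ.+-0-group using () renaming (⁻¹-involutive to neg-involutive)
open import Data.Sum using (inj₁; inj₂)
open import Function using (_∘_)
open import Relation.Binary.PropositionalEquality
open import Relation.Nullary using (does; yes; no)
open import Relation.Nullary.Decidable using (dec-true; dec-false)
open import Tactic.RingSolver using (solve-∀)
open import Tactic.RingSolver.Core.AlmostCommutativeRing using (AlmostCommutativeRing; fromCommutativeRing)

ℚ-ring : AlmostCommutativeRing _ _
ℚ-ring = fromCommutativeRing ℚₚ.+-*-commutativeRing 0≟_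
  where
  0≟_ : ∀ x → Maybe (0ℚ ≡ x)
  0≟ x with 0ℚ ℚₚ.≟ x
  ... | yes 0≡x = just 0≡x
  ... | no _    = nothing

0<F[1+n] : ∀ n → 0 ℕ.< F (suc n)
0<F[1+n] zero          = s≤s z≤n
0<F[1+n] (suc zero)    = s≤s z≤n
0<F[1+n] (suc (suc n)) = ℕₚ.<-≤-trans (0<F[1+n] (suc n)) (ℕₚ.m≤m+n _ _)

F[1+n]<F[2+n] : ∀ n → F (suc n) ℕ.< F (suc (suc n))
F[1+n]<F[2+n] zero    = s≤s (s≤s z≤n)
F[1+n]<F[2+n] (suc n) = ℕₚ.m<m+n (F (suc (suc n))) (0<F[1+n] n)

F[1+_]-mono-< : ∀ {i j} → i ℕ.< j → F (suc i) ℕ.< F (suc j)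
F[1+_]-mono-< {i} {suc j} (s≤s i≤j) with ℕₚ.m≤n⇒m<n∨m≡n i≤j
... | inj₁ i<j  = ℕₚ.<-trans (F[1+_]-mono-< i<j) (F[1+n]<F[2+n] j)
... | inj₂ refl = F[1+n]<F[2+n] i

_∈ᵇ_ : ℕ → List ℕ → Bool
x ∈ᵇ xs = does (x ∈? xs)

∈ᵇ-insert-≢ : ∀ b c {x y} xs → x ≢ y →
              x ∈ᵇ (if b then xs else (if c then y ∷ xs else xs)) ≡ x ∈ᵇ xs
∈ᵇ-insert-≢ true  c     xs x≢y = refl
∈ᵇ-insert-≢ false false xs x≢y = refl
∈ᵇ-insert-≢ false true  {x} {y} xs x≢y = cong (_∨ x ∈ᵇ xs) (dec-false (x ℕ.≟ y) x≢y)

∈ᵇ-insert-≡ : ∀ b c y xs → y ∈ᵇ xs ≡ false →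
              y ∈ᵇ (if b then xs else (if c then y ∷ xs else xs)) ≡ not b ∧ c
∈ᵇ-insert-≡ true  c     y xs y∉xs = y∉xs
∈ᵇ-insert-≡ false false y xs y∉xs = y∉xs
∈ᵇ-insert-≡ false true  y xs y∉xs = cong (_∨ y ∈ᵇ xs) (dec-true (y ℕ.≟ y) refl)

-- The chain is unrolled from the front so that expectations can condition on the first coin;
-- chain-suc is the same recursion read from the back, as A performs it.
chain : Bool → (ℕ → Bool) → ℕ → Bool
chain s ω zero    = s
chain s ω (suc j) = chain (not s ∧ ω 0) (ω ∘ suc) j

chain-suc : ∀ j s ω → chain s ω (suc j) ≡ not (chain s ω j) ∧ ω j
chain-suc zero    s ω = refl
chain-suc (suc j) s ω = chain-suc j (not s ∧ ω 0) (ω ∘ suc)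

blocked : (ℕ → Bool) → ℕ → Bool
blocked ω m = not (m ℕ.≡ᵇ 0) ∧ F m ∈ᵇ A ω m

∉A-before : ∀ ω {n k} → n ℕ.≤ k → F (suc k) ∈ᵇ A ω n ≡ false
∉A-before ω {zero}  _   = refl
∉A-before ω {suc m} m<k = trans
  (∈ᵇ-insert-≢ (blocked ω m) (ω m) (A ω m) (ℕₚ.>⇒≢ (F[1+_]-mono-< m<k)))
  (∉A-before ω (ℕₚ.<⇒≤ m<k))

∈A-after : ∀ ω {n k} → k ℕ.< n → F (suc k) ∈ᵇ A ω n ≡ chain false ω (suc k)
∈A-after ω {suc m} {k} (s≤s k≤m) with ℕₚ.m≤n⇒m<n∨m≡n k≤m
... | inj₁ k<m  = trans
  (∈ᵇ-insert-≢ (blocked ω m) (ω m) (A ω m) (ℕₚ.<⇒≢ (F[1+_]-mono-< k<m)))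
  (∈A-after ω k<m)
... | inj₂ refl = begin
  F (suc k) ∈ᵇ A ω (suc k)                 ≡⟨ ∈ᵇ-insert-≡ (blocked ω k) (ω k) (F (suc k)) (A ω k) (∉A-before ω {k} ℕₚ.≤-refl) ⟩
  not (blocked ω k) ∧ ω k                  ≡⟨ cong (λ b → not b ∧ ω k) (blocked≡chain k) ⟩
  not (chain false ω k) ∧ ω k              ≡⟨ chain-suc k false ω ⟨
  chain false ω (suc k)                    ∎
  where
  open ≡-Reasoning
  blocked≡chain : ∀ j → blocked ω j ≡ chain false ω j
  blocked≡chain zero    = refl
  blocked≡chain (suc j) = ∈A-after ω (ℕₚ.n<1+n j)

ind : Bool → ℚ
ind b = if b then 1ℚ else 0ℚ

sumℚ-++ : ∀ xs ys → sumℚ (xs ++ ys) ≡ sumℚ xs + sumℚ ys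
sumℚ-++ []       ys = sym (ℚₚ.+-identityˡ _)
sumℚ-++ (x ∷ xs) ys = trans (cong (x +_) (sumℚ-++ xs ys)) (sym (ℚₚ.+-assoc x _ _))

mix-self : ∀ p a → p * a + (1ℚ - p) * a ≡ a
mix-self = solve-∀ ℚ-ring

module Expectation (p : ℚ) where

  coin : Bool → ℚ
  coin b = if b then p else 1ℚ - p

  𝔼 : ℕ → (List Bool → ℚ) → ℚ
  𝔼 n f = sumℚ (map (λ bs → weight p bs * f bs) (allBools n))

  𝔼-cong : ∀ n {f g} → (∀ bs → f bs ≡ g bs) → 𝔼 n f ≡ 𝔼 n g
  𝔼-cong n f≗g = cong sumℚ (List.map-cong (λ bs → cong (weight p bs *_) (f≗g bs)) (allBools n))

  sum-weighted-∷ : ∀ b (f : List Bool → ℚ) bss →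
    sumℚ (map (λ bs → weight p bs * f bs) (map (b ∷_) bss))
      ≡ coin b * sumℚ (map (λ bs → weight p bs * f (b ∷ bs)) bss)
  sum-weighted-∷ b f []         = sym (ℚₚ.*-zeroʳ (coin b))
  sum-weighted-∷ b f (bs ∷ bss) = trans
    (cong₂ _+_ (ℚₚ.*-assoc (coin b) (weight p bs) (f (b ∷ bs))) (sum-weighted-∷ b f bss))
    (sym (ℚₚ.*-distribˡ-+ (coin b) _ _))

  𝔼-suc : ∀ n f → 𝔼 (suc n) f ≡ p * 𝔼 n (f ∘ (true ∷_)) + (1ℚ - p) * 𝔼 n (f ∘ (false ∷_))
  𝔼-suc n f = begin
    sumℚ (map g (map (true ∷_) bss ++ map (false ∷_) bss))
      ≡⟨ cong sumℚ (List.map-++ g (map (true ∷_) bss) (map (false ∷_) bss)) ⟩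
    sumℚ (map g (map (true ∷_) bss) ++ map g (map (false ∷_) bss))
      ≡⟨ sumℚ-++ (map g (map (true ∷_) bss)) _ ⟩
    sumℚ (map g (map (true ∷_) bss)) + sumℚ (map g (map (false ∷_) bss))
      ≡⟨ cong₂ _+_ (sum-weighted-∷ true f bss) (sum-weighted-∷ false f bss) ⟩
    p * 𝔼 n (f ∘ (true ∷_)) + (1ℚ - p) * 𝔼 n (f ∘ (false ∷_)) ∎
    where
    open ≡-Reasoning
    bss = allBools n
    g : List Bool → ℚ
    g bs = weight p bs * f bs

  𝔼-const : ∀ n c → 𝔼 n (λ _ → c) ≡ c
  𝔼-const zero    c = trans (cong (_+ 0ℚ) (ℚₚ.*-identityˡ c)) (ℚₚ.+-identityʳ c)
  𝔼-const (suc n) c = begin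
    𝔼 (suc n) (λ _ → c)                             ≡⟨ 𝔼-suc n (λ _ → c) ⟩
    p * 𝔼 n (λ _ → c) + (1ℚ - p) * 𝔼 n (λ _ → c)     ≡⟨ cong (λ a → p * a + (1ℚ - p) * a) (𝔼-const n c) ⟩
    p * c + (1ℚ - p) * c                             ≡⟨ mix-self p c ⟩
    c                                                ∎
    where open ≡-Reasoning

  chainProb : Bool → ℕ → ℚ
  chainProb s     zero    = ind s
  chainProb true  (suc k) = chainProb false k
  chainProb false (suc k) = p * chainProb true k + (1ℚ - p) * chainProb false k

  𝔼-chain : ∀ s {k n} → k ℕ.≤ n → 𝔼 n (λ bs → ind (chain s (toSeq bs) k)) ≡ chainProb s k
  𝔼-chain s     {zero}  {n}     _         = 𝔼-const n (ind s)
  𝔼-chain true  {suc k} {suc n} (s≤s k≤n) = begin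
    𝔼 (suc n) (λ bs → ind (chain true (toSeq bs) (suc k))) ≡⟨ 𝔼-suc n _ ⟩
    p * 𝔼 n h + (1ℚ - p) * 𝔼 n h           ≡⟨ cong (λ a → p * a + (1ℚ - p) * a) (𝔼-chain false k≤n) ⟩
    p * chainProb false k + (1ℚ - p) * chainProb false k ≡⟨ mix-self p _ ⟩
    chainProb false k                      ∎
    where
    open ≡-Reasoning
    h : List Bool → ℚ
    h bs = ind (chain false (toSeq bs) k)
  𝔼-chain false {suc k} {suc n} (s≤s k≤n) = trans (𝔼-suc n _)
    (cong₂ (λ a b → p * a + (1ℚ - p) * b) (𝔼-chain true k≤n) (𝔼-chain false k≤n))

  probIn-after : ∀ {n k} → k ℕ.< n → probIn p n (suc k) ≡ chainProb false (suc k)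
  probIn-after {n} k<n =
    trans (𝔼-cong n (λ bs → cong ind (∈A-after (toSeq bs) k<n))) (𝔼-chain false k<n)

  probIn-before : ∀ {n k} → n ℕ.≤ k → probIn p n (suc k) ≡ 0ℚ
  probIn-before {n} n≤k =
    trans (𝔼-cong n (λ bs → cong ind (∉A-before (toSeq bs) n≤k))) (𝔼-const n 0ℚ)

x≤∣x∣ : ∀ x → x ≤ ∣ x ∣
x≤∣x∣ x with ℚₚ.∣p∣≡p∨∣p∣≡-p x
... | inj₁ ∣x∣≡x  = ℚₚ.≤-reflexive (sym ∣x∣≡x)
... | inj₂ ∣x∣≡-x = ℚₚ.≤-trans x≤0 (ℚₚ.0≤∣p∣ x)
  where
  x≤0 : x ≤ 0ℚ
  x≤0 = subst (_≤ 0ℚ) (neg-involutive x) (ℚₚ.neg-antimono-≤ (subst (0ℚ ≤_) ∣x∣≡-x (ℚₚ.0≤∣p∣ x)))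

-x≤∣x∣ : ∀ x → - x ≤ ∣ x ∣
-x≤∣x∣ x = subst (- x ≤_) (ℚₚ.∣-p∣≡∣p∣ x) (x≤∣x∣ (- x))

∣pow∣ : ∀ q k → ∣ pow q k ∣ ≡ pow ∣ q ∣ k
∣pow∣ q zero    = refl
∣pow∣ q (suc k) = trans (ℚₚ.∣p*q∣≡∣p∣*∣q∣ q (pow q k)) (cong (∣ q ∣ *_) (∣pow∣ q k))

module ClosedForm (p : ℚ) (0<p : 0ℚ < p) where
  open Expectation p

  r : ℚ
  r = ratio p 0<p

  private
    p-pos : Positive p
    p-pos = positive 0<p

    p+1-pos : Positive (p + 1ℚ)
    p+1-pos = ℚₚ.pos+pos⇒pos p {{p-pos}} 1ℚ

    p+1≢0 : NonZero (p + 1ℚ)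
    p+1≢0 = ℚₚ.pos⇒nonZero (p + 1ℚ) {{p+1-pos}}

  r+pr≡p : r + p * r ≡ p
  r+pr≡p = begin
    p * i + p * (p * i) ≡⟨ p*i+p*[p*i]≡p*[[p+1]*i] p i ⟩
    p * ((p + 1ℚ) * i)  ≡⟨ cong (p *_) (ℚₚ.*-inverseʳ (p + 1ℚ) {{p+1≢0}}) ⟩
    p * 1ℚ              ≡⟨ ℚₚ.*-identityʳ p ⟩
    p                   ∎
    where
    open ≡-Reasoning
    i = (1/ (p + 1ℚ)) {{p+1≢0}}
    p*i+p*[p*i]≡p*[[p+1]*i] : ∀ p i → p * i + p * (p * i) ≡ p * ((p + 1ℚ) * i)
    p*i+p*[p*i]≡p*[[p+1]*i] = solve-∀ ℚ-ring

  chainProb-closed : ∀ k → chainProb false k ≡ r - r * pow (- p) k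
  chainProb-closed zero = sym (r-r*1≡0 r)
    where
    r-r*1≡0 : ∀ r → r - r * 1ℚ ≡ 0ℚ
    r-r*1≡0 = solve-∀ ℚ-ring
  chainProb-closed (suc zero) = begin
    p * 1ℚ + (1ℚ - p) * 0ℚ ≡⟨ p*1+[1-p]*0≡p p ⟩
    p                      ≡⟨ r+pr≡p ⟨
    r + p * r              ≡⟨ r+pr≡r-r*[-p*1] p r ⟩
    r - r * (- p * 1ℚ)     ∎
    where
    open ≡-Reasoning
    p*1+[1-p]*0≡p : ∀ p → p * 1ℚ + (1ℚ - p) * 0ℚ ≡ p
    p*1+[1-p]*0≡p = solve-∀ ℚ-ring
    r+pr≡r-r*[-p*1] : ∀ p r → r + p * r ≡ r - r * (- p * 1ℚ)
    r+pr≡r-r*[-p*1] = solve-∀ ℚ-ring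
  chainProb-closed (suc (suc k)) = begin
    p * chainProb false k + (1ℚ - p) * chainProb false (suc k)
      ≡⟨ cong₂ (λ a b → p * a + (1ℚ - p) * b) (chainProb-closed k) (chainProb-closed (suc k)) ⟩
    p * (r - r * x) + (1ℚ - p) * (r - r * (- p * x))
      ≡⟨ renewal p r x ⟩
    r - r * (- p * (- p * x)) ∎
    where
    open ≡-Reasoning
    x = pow (- p) k
    renewal : ∀ p r x → p * (r - r * x) + (1ℚ - p) * (r - r * (- p * x)) ≡ r - r * (- p * (- p * x))
    renewal = solve-∀ ℚ-ring

  0≤r : 0ℚ ≤ r
  0≤r = ℚₚ.nonNegative⁻¹ r {{ℚₚ.pos⇒nonNeg r {{r-pos}}}}
    where
    r-pos : Positive r
    r-pos = ℚₚ.pos*pos⇒pos p {{p-pos}} _ {{ℚₚ.1/pos⇒pos (p + 1ℚ) {{p+1-pos}}}}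

  ∣error∣ : ∀ k → ∣ r * pow (- p) k ∣ ≡ r * pow p k
  ∣error∣ k = begin
    ∣ r * pow (- p) k ∣       ≡⟨ ℚₚ.∣p*q∣≡∣p∣*∣q∣ r (pow (- p) k) ⟩
    ∣ r ∣ * ∣ pow (- p) k ∣   ≡⟨ cong₂ _*_ (ℚₚ.0≤p⇒∣p∣≡p 0≤r) (∣pow∣ (- p) k) ⟩
    r * pow ∣ - p ∣ k         ≡⟨ cong (λ q → r * pow q k) (trans (ℚₚ.∣-p∣≡∣p∣ p) (ℚₚ.0≤p⇒∣p∣≡p (ℚₚ.<⇒≤ 0<p))) ⟩
    r * pow p k               ∎
    where open ≡-Reasoning

  0≤r*p^k : ∀ k → 0ℚ ≤ r * pow p k
  0≤r*p^k k = subst (0ℚ ≤_) (∣error∣ k) (ℚₚ.0≤∣p∣ _)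

  chainProb-≤ : ∀ k → chainProb false k ≤ r + r * pow p k
  chainProb-≤ k = subst₂ _≤_ (sym (chainProb-closed k)) (cong (r +_) (∣error∣ k))
    (ℚₚ.+-monoʳ-≤ r (-x≤∣x∣ (r * pow (- p) k)))

  chainProb-≥ : ∀ k → r - r * pow p k ≤ chainProb false k
  chainProb-≥ k = subst₂ _≤_ (cong (λ a → r - a) (∣error∣ k)) (sym (chainProb-closed k))
    (ℚₚ.+-monoʳ-≤ r (ℚₚ.neg-antimono-≤ (x≤∣x∣ (r * pow (- p) k))))

lemma3p1 : (p : ℚ) (0<p : 0ℚ < p) → p < 1ℚ →
    ∃[ C ] ((k : ℕ) → 1 Data.Nat.≤ k →
      ((n : ℕ) → probIn p n k ≤ ratio p 0<p + C * pow p k)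
      × ((ε : ℚ) → 0ℚ < ε → ∃[ n ] (ratio p 0<p - C * pow p k - ε < probIn p n k)))
lemma3p1 p 0<p _ = r , λ { (suc k) _ → upper k , lower k }
  where
  open Expectation p
  open ClosedForm p 0<p
  open ℚₚ.≤-Reasoning

  upper : ∀ k n → probIn p n (suc k) ≤ r + r * pow p (suc k)
  upper k n with k ℕ.<? n
  ... | yes k<n = begin
    probIn p n (suc k)     ≡⟨ probIn-after k<n ⟩
    chainProb false (suc k) ≤⟨ chainProb-≤ (suc k) ⟩
    r + r * pow p (suc k)  ∎
  ... | no  k≮n = begin
    probIn p n (suc k)     ≡⟨ probIn-before (ℕₚ.≮⇒≥ k≮n) ⟩
    0ℚ                     ≤⟨ ℚₚ.+-mono-≤ 0≤r (0≤r*p^k (suc k)) ⟩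
    r + r * pow p (suc k)  ∎

  lower : ∀ k ε → 0ℚ < ε → ∃[ n ] (r - r * pow p (suc k) - ε < probIn p n (suc k))
  lower k ε 0<ε = suc k , (begin-strict
    r - r * pow p (suc k) - ε        <⟨ ℚₚ.+-monoʳ-< (r - r * pow p (suc k)) (ℚₚ.neg-antimono-< 0<ε) ⟩
    r - r * pow p (suc k) + 0ℚ       ≡⟨ ℚₚ.+-identityʳ _ ⟩
    r - r * pow p (suc k)            ≤⟨ chainProb-≥ (suc k) ⟩
    chainProb false (suc k)          ≡⟨ probIn-after (ℕₚ.n<1+n k) ⟨
    probIn p (suc k) (suc k)         ∎)
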